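{- Let $r\in\{1,2,3\}$ and let $G$ be a strong $r$-central $2$-tree on $n$ vertices with maximum degree $\Delta$ and tail set $\{2,3\}$. Then $\frac{n+3r-6}{r}\le \Delta\le \frac{2n+2r-6}{r}$, and in addition $\Delta\le n-1$.
   Context: A $2$-tree is a graph obtained from the triangle $K_3$ by repeatedly adding a new vertex adjacent to both endpoints of an existing edge. For $r\in\{1,2,3\}$ and an integer $\Delta\ge 2$, a $2$-tree on $n$ vertices is $r$-central with maximum degree $\Delta$ if $\Delta$ is its maximum degree and exactly $r$ vertices have degree $\Delta$; these $r$ vertices form the core and the other $n-r$ vertices form the tail. It is strong if the core induces $K_r$. It has tail set $\{2,3\}$ if every tail vertex has degree $2$ or $3$. -}

module Defs where

open import Data.Nat using (ℕ; zero; suc; _+_; _*_; _≤_; _≡ᵇ_)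
open import Data.Fin using (Fin; zero; suc; _≟_)
open import Data.Bool using (Bool; true; false; not; _∨_; if_then_else_)
open import Data.List using (List; map)
open import Data.Nat.ListAction using (sum)
open import Data.List.Base using (allFin)
open import Relation.Nullary.Decidable using (⌊_⌋)
open import Relation.Binary.PropositionalEquality using (_≡_; _≢_)
open import Data.Sum using (_⊎_)
open import Data.Product using (_×_)

_==_ : ∀ {n} → Fin n → Fin n → Bool
u == v = ⌊ u ≟ v ⌋

-- 2-trees on n vertices (vertex set Fin n), given by their construction:
-- start from the triangle K₃, repeatedly add a new vertex (numbered zero,
-- old vertices shifted by suc) adjacent to both endpoints of an existing edge.
data TwoTree : ℕ → Set
adj : ∀ {n} → TwoTree n → Fin n → Fin n → Bool

data TwoTree where
  triangle : TwoTree 3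
  extend   : ∀ {n} (T : TwoTree n) (a b : Fin n) → adj T a b ≡ true → TwoTree (suc n)

adj triangle u v = not (u == v)
adj (extend T a b _) zero    zero    = false
adj (extend T a b _) zero    (suc w) = (w == a) ∨ (w == b)
adj (extend T a b _) (suc w) zero    = (w == a) ∨ (w == b)
adj (extend T a b _) (suc x) (suc y) = adj T x y

countV : ∀ {n} → (Fin n → Bool) → ℕ
countV {n} P = sum (map (λ v → if P v then 1 else 0) (allFin n))

deg : ∀ {n} → TwoTree n → Fin n → ℕ
deg T v = countV (adj T v)

-- G is r-central with maximum degree Δ: Δ is the maximum degree and exactly
-- r vertices have degree Δ (these form the core; with r ≥ 1 this forces Δ
-- to be attained, i.e. to be the maximum degree).
IsCentral : ∀ {n} → TwoTree n → (r Δ : ℕ) → Set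
IsCentral T r Δ = (∀ v → deg T v ≤ Δ) × countV (λ v → deg T v ≡ᵇ Δ) ≡ r

InCore : ∀ {n} → TwoTree n → ℕ → Fin n → Set
InCore T Δ v = deg T v ≡ Δ

Strong : ∀ {n} → TwoTree n → ℕ → Set
Strong T Δ = ∀ u v → InCore T Δ u → InCore T Δ v → u ≢ v → adj T u v ≡ true

TailSet23 : ∀ {n} → TwoTree n → ℕ → Set
TailSet23 T Δ = ∀ v → deg T v ≢ Δ → (deg T v ≡ 2 ⊎ deg T v ≡ 3)

{-# OPTIONS --safe #-}
-- Summing degrees along the construction of a 2-tree gives 4n − 6 (each new
-- vertex adds 2 to its own degree and 1 to each of two old ones). The r core
-- vertices contribute rΔ and each of the n − r tail vertices 2 or 3, so
-- 2(n − r) ≤ 4n − 6 − rΔ ≤ 3(n − r), which rearranges to the two bounds.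
-- A core vertex exists and is not adjacent to itself, so Δ ≤ n − 1.
module Submission where

open import Defs
open import Data.Bool using (Bool; true; false; not; _∨_; if_then_else_; T)
open import Data.Empty using (⊥)
open import Data.Fin using (Fin; zero; suc; _≟_)
open import Data.Fin.Properties using (suc-injective)
open import Data.List using (map; tabulate; _∷_; [])
open import Data.Nat using (ℕ; zero; suc; _+_; _*_; _≤_; _<_; _≡ᵇ_; z≤n; s≤s)
open import Data.Nat.ListAction using () renaming (sum to sumᴸ)
open import Data.Nat.Properties
  using ( ≤-reflexive; ≤-trans; n≤1+n; +-mono-≤; +-monoˡ-≤; +-cancelʳ-≤
        ; +-comm; +-identityʳ; *-suc; ≡ᵇ⇒≡; ≡⇒≡ᵇ; +-*-semiring; module ≤-Reasoning)
open import Algebra.Properties.Semiring.Sum +-*-semiring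
  using (sum-cong-≗; sum-replicate-zero; sum-remove; ∑-distrib-+; *-distribʳ-sum)
  renaming (sum to ∑)
open import Data.Nat.Tactic.RingSolver using (solve)
open import Data.Product using (_×_; _,_; ∃; proj₁; proj₂)
open import Data.Sum using (inj₁; inj₂)
open import Data.Vec.Functional using (removeAt)
open import Function using (_∘_)
open import Relation.Binary.PropositionalEquality
open import Relation.Nullary.Decidable using (isYes≗does; dec-true; toWitness; ⌊⌋-map′)

n+3r≤rΔ+6 : ∀ n r Δ {S} → S + 6 ≡ 4 * n → S + r * 3 ≤ n * 3 + r * Δ →
            n + 3 * r ≤ r * Δ + 6
n+3r≤rΔ+6 n r Δ {S} S+6≡4n S+3r≤3n+rΔ =
  +-cancelʳ-≤ (n * 3) (n + 3 * r) (r * Δ + 6) (begin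
    n + 3 * r + n * 3      ≡⟨ solve (n ∷ r ∷ []) ⟩
    4 * n + r * 3          ≡⟨ cong (_+ r * 3) S+6≡4n ⟨
    S + 6 + r * 3          ≡⟨ solve (S ∷ r ∷ []) ⟩
    S + r * 3 + 6          ≤⟨ +-monoˡ-≤ 6 S+3r≤3n+rΔ ⟩
    n * 3 + r * Δ + 6      ≡⟨ solve (n ∷ r ∷ Δ ∷ []) ⟩
    r * Δ + 6 + n * 3      ∎)
  where open ≤-Reasoning

rΔ+6≤2n+2r : ∀ n r Δ {S} → S + 6 ≡ 4 * n → n * 2 + r * Δ ≤ S + r * 2 →
             r * Δ + 6 ≤ 2 * n + 2 * r
rΔ+6≤2n+2r n r Δ {S} S+6≡4n 2n+rΔ≤S+2r =
  +-cancelʳ-≤ (n * 2) (r * Δ + 6) (2 * n + 2 * r) (begin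
    r * Δ + 6 + n * 2      ≡⟨ solve (n ∷ r ∷ Δ ∷ []) ⟩
    n * 2 + r * Δ + 6      ≤⟨ +-monoˡ-≤ 6 2n+rΔ≤S+2r ⟩
    S + r * 2 + 6          ≡⟨ solve (S ∷ r ∷ []) ⟩
    S + 6 + r * 2          ≡⟨ cong (_+ r * 2) S+6≡4n ⟩
    4 * n + r * 2          ≡⟨ solve (n ∷ r ∷ []) ⟩
    2 * n + 2 * r + n * 2  ∎)
  where open ≤-Reasoning

indicator : Bool → ℕ
indicator b = if b then 1 else 0

indicator≤1 : ∀ b → indicator b ≤ 1
indicator≤1 true  = s≤s z≤n
indicator≤1 false = z≤n

indicator-∨-disjoint : ∀ p q → (p ≡ true → q ≡ true → ⊥) →
                       indicator (p ∨ q) ≡ indicator p + indicator q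
indicator-∨-disjoint true  true  disjoint with () ← disjoint refl refl
indicator-∨-disjoint true  false _ = refl
indicator-∨-disjoint false q     _ = refl

∑-const : ∀ {n} c → ∑ {n} (λ _ → c) ≡ n * c
∑-const {zero}  c = refl
∑-const {suc n} c = cong (c +_) (∑-const {n} c)

∑-mono-≤ : ∀ {n} {f g : Fin n → ℕ} → (∀ v → f v ≤ g v) → ∑ f ≤ ∑ g
∑-mono-≤ {zero}  f≤g = z≤n
∑-mono-≤ {suc n} f≤g = +-mono-≤ (f≤g zero) (∑-mono-≤ (f≤g ∘ suc))

∑-indicator≤n : ∀ {n} (P : Fin n → Bool) → ∑ (indicator ∘ P) ≤ n
∑-indicator≤n {zero}  P = z≤n
∑-indicator≤n {suc n} P = +-mono-≤ (indicator≤1 (P zero)) (∑-indicator≤n (P ∘ suc))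

0<∑-indicator⇒∃ : ∀ {n} (P : Fin n → Bool) → 0 < ∑ (indicator ∘ P) →
                  ∃ λ v → P v ≡ true
0<∑-indicator⇒∃ {suc n} P 0<∑ with P zero in P0
... | true  = zero , P0
... | false with v , Pv ← 0<∑-indicator⇒∃ (P ∘ suc) 0<∑ = suc v , Pv

sumᴸ-map-tabulate : ∀ {m n} (f : Fin m → ℕ) (g : Fin n → Fin m) →
                    sumᴸ (map f (tabulate g)) ≡ ∑ (f ∘ g)
sumᴸ-map-tabulate {n = zero}  f g = refl
sumᴸ-map-tabulate {n = suc n} f g = cong (f (g zero) +_) (sumᴸ-map-tabulate f (g ∘ suc))

countV≡∑ : ∀ {n} (P : Fin n → Bool) → countV P ≡ ∑ (indicator ∘ P)
countV≡∑ P = sumᴸ-map-tabulate (indicator ∘ P) (λ v → v)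

∑-+-countV* : ∀ {n} (f : Fin n → ℕ) (P : Fin n → Bool) k →
              ∑ (λ v → f v + indicator (P v) * k) ≡ ∑ f + countV P * k
∑-+-countV* f P k = begin
  ∑ (λ v → f v + indicator (P v) * k)  ≡⟨ ∑-distrib-+ f (λ v → indicator (P v) * k) ⟩
  ∑ f + ∑ (λ v → indicator (P v) * k)  ≡⟨ cong (∑ f +_) (*-distribʳ-sum k (indicator ∘ P)) ⟨
  ∑ f + ∑ (indicator ∘ P) * k          ≡⟨ cong (λ m → ∑ f + m * k) (countV≡∑ P) ⟨
  ∑ f + countV P * k                   ∎
  where open ≡-Reasoning

countV<n : ∀ {n} (P : Fin n → Bool) {v : Fin n} → P v ≡ false → countV P < n
countV<n {suc m} P {v} Pv≡false = s≤s (begin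
  countV P                              ≡⟨ countV≡∑ P ⟩
  ∑ (indicator ∘ P)                     ≡⟨ sum-remove {i = v} (indicator ∘ P) ⟩
  indicator (P v) + ∑ (indicator ∘ P′)  ≡⟨ cong (_+ ∑ (indicator ∘ P′)) (cong indicator Pv≡false) ⟩
  ∑ (indicator ∘ P′)                    ≤⟨ ∑-indicator≤n P′ ⟩
  m                                     ∎)
  where
  open ≤-Reasoning
  P′ : Fin m → Bool
  P′ = removeAt P v

==-refl : ∀ {n} (v : Fin n) → (v == v) ≡ true
==-refl v = trans (isYes≗does (v ≟ v)) (dec-true (v ≟ v) refl)

==⇒≡ : ∀ {n} {u v : Fin n} → (u == v) ≡ true → u ≡ v
==⇒≡ u==v = toWitness (subst T (sym u==v) _)

==-suc : ∀ {n} (u v : Fin n) → (suc u == suc v) ≡ (u == v)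
==-suc u v = ⌊⌋-map′ (cong suc) suc-injective (u ≟ v)

∑-indicator-== : ∀ {n} (a : Fin n) → ∑ (λ w → indicator (w == a)) ≡ 1
∑-indicator-== {suc n} zero    = cong suc (sum-replicate-zero n)
∑-indicator-== {suc n} (suc a) = begin
  ∑ (λ w → indicator (suc w == suc a))  ≡⟨ sum-cong-≗ (λ w → cong indicator (==-suc w a)) ⟩
  ∑ (λ w → indicator (w == a))          ≡⟨ ∑-indicator-== a ⟩
  1                                     ∎
  where open ≡-Reasoning

∑-indicator-pair : ∀ {n} {a b : Fin n} → a ≢ b →
                   ∑ (λ w → indicator ((w == a) ∨ (w == b))) ≡ 2
∑-indicator-pair {n} {a} {b} a≢b = begin
  ∑ (λ w → indicator ((w == a) ∨ (w == b)))    ≡⟨ sum-cong-≗ disjoint ⟩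
  ∑ (λ w → point a w + point b w)              ≡⟨ ∑-distrib-+ (point a) (point b) ⟩
  ∑ (point a) + ∑ (point b)                    ≡⟨ cong₂ _+_ (∑-indicator-== a) (∑-indicator-== b) ⟩
  2                                            ∎
  where
  open ≡-Reasoning
  point : Fin n → Fin n → ℕ
  point c w = indicator (w == c)
  disjoint : ∀ w → indicator ((w == a) ∨ (w == b)) ≡ point a w + point b w
  disjoint w = indicator-∨-disjoint (w == a) (w == b)
                 λ w≡a w≡b → a≢b (trans (sym (==⇒≡ w≡a)) (==⇒≡ w≡b))

adj-irrefl : ∀ {n} (G : TwoTree n) (v : Fin n) → adj G v v ≡ false
adj-irrefl triangle         v       = cong not (==-refl v)
adj-irrefl (extend G a b _) zero    = refl
adj-irrefl (extend G a b _) (suc v) = adj-irrefl G v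

adj⇒≢ : ∀ {n} (G : TwoTree n) {u v : Fin n} → adj G u v ≡ true → u ≢ v
adj⇒≢ G {u} adj-uv refl with () ← trans (sym adj-uv) (adj-irrefl G u)

deg<n : ∀ {n} (G : TwoTree n) (v : Fin n) → deg G v < n
deg<n G v = countV<n (adj G v) (adj-irrefl G v)

module _ {n} (G : TwoTree n) {a b : Fin n} (adj-ab : adj G a b ≡ true) where

  deg-extend-new : deg (extend G a b adj-ab) zero ≡ 2
  deg-extend-new = trans (countV≡∑ (adj (extend G a b adj-ab) zero))
                         (∑-indicator-pair (adj⇒≢ G adj-ab))

  deg-extend-old : ∀ v →
                   deg (extend G a b adj-ab) (suc v) ≡ indicator ((v == a) ∨ (v == b)) + deg G v
  deg-extend-old v = trans (countV≡∑ (adj (extend G a b adj-ab) (suc v)))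
                           (cong (indicator ((v == a) ∨ (v == b)) +_) (sym (countV≡∑ (adj G v))))

∑-deg : ∀ {n} (G : TwoTree n) → ∑ (deg G) + 6 ≡ 4 * n
∑-deg triangle = refl
∑-deg {suc n} (extend G a b adj-ab) = begin
  ∑ (deg (extend G a b adj-ab)) + 6
    ≡⟨ cong₂ (λ x y → x + y + 6) (deg-extend-new G adj-ab)
                                 (sum-cong-≗ (deg-extend-old G adj-ab)) ⟩
  2 + ∑ (λ v → new-neighbour v + deg G v) + 6
    ≡⟨ cong (λ x → 2 + x + 6) (∑-distrib-+ new-neighbour (deg G)) ⟩
  2 + (∑ new-neighbour + ∑ (deg G)) + 6
    ≡⟨ cong (λ x → 2 + (x + ∑ (deg G)) + 6) (∑-indicator-pair (adj⇒≢ G adj-ab)) ⟩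
  4 + (∑ (deg G) + 6)
    ≡⟨ cong (4 +_) (∑-deg G) ⟩
  4 + 4 * n
    ≡⟨ *-suc 4 n ⟨
  4 * suc n
    ∎
  where
  open ≡-Reasoning
  new-neighbour : Fin n → ℕ
  new-neighbour v = indicator ((v == a) ∨ (v == b))

module _ {n} (G : TwoTree n) (Δ : ℕ) where

  core : Fin n → Bool
  core v = deg G v ≡ᵇ Δ

  |core| : ℕ
  |core| = countV core

  core⇒deg≡Δ : ∀ {v} → core v ≡ true → deg G v ≡ Δ
  core⇒deg≡Δ {v} core-v = ≡ᵇ⇒≡ (deg G v) Δ (subst T (sym core-v) _)

  ¬core⇒2≤deg≤3 : TailSet23 G Δ → ∀ {v} → core v ≡ false → 2 ≤ deg G v × deg G v ≤ 3
  ¬core⇒2≤deg≤3 tail-23 {v} ¬core-v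
    with tail-23 v (λ deg≡Δ → subst T ¬core-v (≡⇒≡ᵇ (deg G v) Δ deg≡Δ))
  ... | inj₁ deg≡2 = ≤-reflexive (sym deg≡2) , ≤-trans (≤-reflexive deg≡2) (n≤1+n 2)
  ... | inj₂ deg≡3 = ≤-trans (n≤1+n 2) (≤-reflexive (sym deg≡3)) , ≤-reflexive deg≡3

  deg-upper : TailSet23 G Δ → ∀ v →
              deg G v + indicator (core v) * 3 ≤ 3 + indicator (core v) * Δ
  deg-upper tail-23 v with core v in core-v
  ... | true  = ≤-reflexive (begin-equality
    deg G v + 3  ≡⟨ cong (_+ 3) (core⇒deg≡Δ core-v) ⟩
    Δ + 3        ≡⟨ +-comm Δ 3 ⟩
    3 + Δ        ≡⟨ cong (3 +_) (+-identityʳ Δ) ⟨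
    3 + (Δ + 0)  ∎)
    where open ≤-Reasoning
  ... | false = ≤-trans (≤-reflexive (+-identityʳ (deg G v)))
                        (proj₂ (¬core⇒2≤deg≤3 tail-23 core-v))

  deg-lower : TailSet23 G Δ → ∀ v →
              2 + indicator (core v) * Δ ≤ deg G v + indicator (core v) * 2
  deg-lower tail-23 v with core v in core-v
  ... | true  = ≤-reflexive (begin-equality
    2 + (Δ + 0)  ≡⟨ cong (2 +_) (+-identityʳ Δ) ⟩
    2 + Δ        ≡⟨ +-comm 2 Δ ⟩
    Δ + 2        ≡⟨ cong (_+ 2) (core⇒deg≡Δ core-v) ⟨
    deg G v + 2  ∎)
    where open ≤-Reasoning
  ... | false = ≤-trans (proj₁ (¬core⇒2≤deg≤3 tail-23 core-v))
                        (≤-reflexive (sym (+-identityʳ (deg G v))))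

  ∑-deg-upper : TailSet23 G Δ → ∑ (deg G) + |core| * 3 ≤ n * 3 + |core| * Δ
  ∑-deg-upper tail-23 = begin
    ∑ (deg G) + |core| * 3                      ≡⟨ ∑-+-countV* (deg G) core 3 ⟨
    ∑ (λ v → deg G v + indicator (core v) * 3)  ≤⟨ ∑-mono-≤ (deg-upper tail-23) ⟩
    ∑ (λ v → 3 + indicator (core v) * Δ)        ≡⟨ ∑-+-countV* (λ _ → 3) core Δ ⟩
    ∑ {n} (λ _ → 3) + |core| * Δ                ≡⟨ cong (_+ |core| * Δ) (∑-const {n} 3) ⟩
    n * 3 + |core| * Δ                          ∎
    where open ≤-Reasoning

  ∑-deg-lower : TailSet23 G Δ → n * 2 + |core| * Δ ≤ ∑ (deg G) + |core| * 2
  ∑-deg-lower tail-23 = begin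
    n * 2 + |core| * Δ                          ≡⟨ cong (_+ |core| * Δ) (∑-const {n} 2) ⟨
    ∑ {n} (λ _ → 2) + |core| * Δ                ≡⟨ ∑-+-countV* (λ _ → 2) core Δ ⟨
    ∑ (λ v → 2 + indicator (core v) * Δ)        ≤⟨ ∑-mono-≤ (deg-lower tail-23) ⟩
    ∑ (λ v → deg G v + indicator (core v) * 2)  ≡⟨ ∑-+-countV* (deg G) core 2 ⟩
    ∑ (deg G) + |core| * 2                      ∎
    where open ≤-Reasoning

  Δ<n : 0 < |core| → Δ < n
  Δ<n 0<|core|
    with v , core-v ← 0<∑-indicator⇒∃ core (subst (0 <_) (countV≡∑ core) 0<|core|)
    = subst (_< n) (core⇒deg≡Δ core-v) (deg<n G v)

corollary2p2 : (r n Δ : ℕ) → 1 ≤ r → r ≤ 3 → 2 ≤ Δ → (G : TwoTree n) →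
    IsCentral G r Δ → Strong G Δ → TailSet23 G Δ →
    (n + 3 * r ≤ r * Δ + 6) × (r * Δ + 6 ≤ 2 * n + 2 * r) × (Δ + 1 ≤ n)
corollary2p2 _ n Δ 0<|core| _ _ G (_ , refl) _ tail-23 =
    n+3r≤rΔ+6 n (|core| G Δ) Δ (∑-deg G) (∑-deg-upper G Δ tail-23)
  , rΔ+6≤2n+2r n (|core| G Δ) Δ (∑-deg G) (∑-deg-lower G Δ tail-23)
  , subst (_≤ n) (+-comm 1 Δ) (Δ<n G Δ 0<|core|)
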